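{- Let $T_1=\langle Q_1,L_1,\twoheadrightarrow_1,Q^0_1,Y,H_1\rangle$ and $T_2=\langle Q_2,L_2,\twoheadrightarrow_2,Q^0_2,Y,H_2\rangle$ be two ($\tau$-compressed) metric transition systems with the same output set $Y$ and metric $\mathbf{d}$, and suppose $T_1\cong_{h,\varepsilon}T_2$. Then for every observation trajectory $y^0_1\overset{l_0}{\twoheadrightarrow}y^1_1\overset{l_1}{\twoheadrightarrow}y^2_1\overset{l_2}{\twoheadrightarrow}\cdots$ of $T_1$ there exists an observation trajectory $y^0_2\overset{l'_0}{\Longrightarrow}y^1_2\overset{l'_1}{\Longrightarrow}y^2_2\overset{l'_2}{\Longrightarrow}\cdots$ of $T_2$ such that for all $i\in\mathbb{N}$, $\mathbf{d}(y^i_1,y^i_2)\le\varepsilon$ and $\mathbf{d}_L(l_i,l'_i)\le h$.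
   Context: The set of actions $\mathit{Act}$ consists of a set $\mathcal{E}$ of discrete (instantaneous) actions, the set $\mathbb{R}^+_0$ of delay actions, and a special internal action $\tau$. A labeled transition system with observations is a tuple $T=\langle Q,L,\to,Q^0,Y,H\rangle$ with state set $Q$, label set $L\subseteq \mathit{Act}$, transition relation $\to\subseteq Q\times L\times Q$, initial states $Q^0\subseteq Q$, observation set $Y$ and observation map $H:Q\to Y$, such that $q\xrightarrow{0}q$ always holds and delay transitions are deterministic and additive. It is metric if $Y$ carries a metric $\mathbf{d}$; here $\mathbf{d}(y_1,y_2)=\|y_1-y_2\|$ (infinity norm). The $\tau$-compressed version replaces every maximal sequence of $\tau$-transitions by a single $\tau$-transition $\overset{\tau}{\twoheadrightarrow}$ and keeps each non-$\tau$ transition $q\xrightarrow{l}q'$ as $q\overset{l}{\twoheadrightarrow}q'$. $p\overset{l}{\Longrightarrow}p'$ means $p\,(\overset{\tau}{\twoheadrightarrow})^{\{0,1\}}\overset{l}{\twoheadrightarrow}(\overset{\tau}{\twoheadrightarrow})^{\{0,1\}}\,p'$. A state trajectory of a transition system is a (possibly infinite) sequence of transitions $q^0\xrightarrow{l^0}q^1\xrightarrow{l^1}\cdots$ with $q^0$ an initial state; an observation trajectory $y^0\xrightarrow{l^0}y^1\xrightarrow{l^1}\cdots$ is one of the system if there is a state trajectory with the same labels and $y^i=H(q^i)$ for all $i$ (for $T_2$ the analogous notion is used with $\Longrightarrow$-steps). Label distance: $\mathbf{d}_L(l_1,l_2)=0$ if both are in $\mathcal{E}$ or both are $\tau$; $|d-d'|$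 if both are delays $d,d'$; $\infty$ otherwise. A relation $\mathcal{B}\subseteq Q_1\times Q_2$ is a $(h,\varepsilon)$-approximate bisimulation relation if for all $(q_1,q_2)\in\mathcal{B}$: $\mathbf{d}(H_1(q_1),H_2(q_2))\le\varepsilon$; every $q_1\overset{l}{\twoheadrightarrow}_1q_1'$ is matched by some $q_2\overset{l'}{\Longrightarrow}_2q_2'$ with $\mathbf{d}_L(l,l')\le h$ and $(q_1',q_2')\in\mathcal{B}$; and every $q_2\overset{l}{\twoheadrightarrow}_2q_2'$ is matched by some $q_1\overset{l'}{\Longrightarrow}_1q_1'$ with $\mathbf{d}_L(l,l')\le h$ and $(q_1',q_2')\in\mathcal{B}$. $T_1\cong_{h,\varepsilon}T_2$ means there is such a relation $\mathcal{B}$ with: for every $q_1\in Q^0_1$ some $q_2\in Q^0_2$ has $(q_1,q_2)\in\mathcal{B}$, and for every $q_2\in Q^0_2$ some $q_1\in Q^0_1$ has $(q_1,q_2)\in\mathcal{B}$. -}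

module Defs where

open import Data.Nat using (ℕ; suc; _<_; _≤_)
open import Data.Unit using (⊤)
open import Data.Empty using (⊥)
open import Data.Product using (Σ; _×_)
open import Relation.Binary.PropositionalEquality using (_≡_)

-- We abstract over a
-- "real-number-like" carrier with exactly the operations the notions
-- in the statement use (order, subtraction, absolute value, zero).
record RealLike : Set₁ where
  field
    ℝ   : Set
    _≤ℝ_ : ℝ → ℝ → Set
    _-ℝ_ : ℝ → ℝ → ℝ
    ∣_∣ℝ : ℝ → ℝ
    0ℝ  : ℝ

module _ (R : RealLike) where
  open RealLike R

  data Act (E : Set) : Set where
    ev    : E → Act E
    delay : ℝ → Act E
    τ     : Act E

  data ℝ∞ : Set where
    fin : ℝ → ℝ∞
    ∞   : ℝ∞

  _≤∞_ : ℝ∞ → ℝ → Set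
  fin x ≤∞ h = x ≤ℝ h
  ∞     ≤∞ h = ⊥

  dL : {E : Set} → Act E → Act E → ℝ∞
  dL (ev _)    (ev _)     = fin 0ℝ
  dL τ         τ          = fin 0ℝ
  dL (delay a) (delay b)  = fin ∣ a -ℝ b ∣ℝ
  dL _         _          = ∞

  record TS (E Y : Set) : Set₁ where
    field
      Q    : Set
      step : Q → Act E → Q → Set
      Init : Q → Set
      H    : Q → Y

  module _ {E Y : Set} (T : TS E Y) where
    open TS T

    data TauOpt : Q → Q → Set where
      none : ∀ {p} → TauOpt p p
      one  : ∀ {p p'} → step p τ p' → TauOpt p p'

    data WStep : Q → Act E → Q → Set where
      wstep : ∀ {p p₁ p₂ p' l} → TauOpt p p₁ → step p₁ l p₂ → TauOpt p₂ p' → WStep p l p'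

  -- Lengths of (possibly infinite) trajectories: number of transitions.
  data Len : Set where
    finite : ℕ → Len
    infinite : Len

  -- index of a transition that exists
  _<L_ : ℕ → Len → Set
  i <L finite n = i < n
  i <L infinite = ⊤

  -- index of a state that exists
  _≤L_ : ℕ → Len → Set
  i ≤L finite n = i ≤ n
  i ≤L infinite = ⊤

  ObsTraj : {E Y : Set} (T : TS E Y) → Len → (ℕ → Y) → (ℕ → Act E) → Set
  ObsTraj T n y l =
    Σ (ℕ → TS.Q T) λ q →
      TS.Init T (q 0)
      × (∀ i → i <L n → TS.step T (q i) (l i) (q (suc i)))
      × (∀ i → i ≤L n → TS.H T (q i) ≡ y i)

  WObsTraj : {E Y : Set} (T : TS E Y) → Len → (ℕ → Y) → (ℕ → Act E) → Set
  WObsTraj T n y l =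
    Σ (ℕ → TS.Q T) λ q →
      TS.Init T (q 0)
      × (∀ i → i <L n → WStep T (q i) (l i) (q (suc i)))
      × (∀ i → i ≤L n → TS.H T (q i) ≡ y i)

  module _ {E Y : Set} (d : Y → Y → ℝ) (h ε : ℝ) (T₁ T₂ : TS E Y) where
    private
      module T₁ = TS T₁
      module T₂ = TS T₂

    record IsApproxBisim (B : T₁.Q → T₂.Q → Set) : Set where
      field
        close : ∀ {q₁ q₂} → B q₁ q₂ → d (T₁.H q₁) (T₂.H q₂) ≤ℝ ε
        fwd   : ∀ {q₁ q₂ l q₁'} → B q₁ q₂ → T₁.step q₁ l q₁' →
                Σ (Act E) λ l' → Σ T₂.Q λ q₂' →
                  WStep T₂ q₂ l' q₂' × (dL l l' ≤∞ h) × B q₁' q₂'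
        bwd   : ∀ {q₁ q₂ l q₂'} → B q₁ q₂ → T₂.step q₂ l q₂' →
                Σ (Act E) λ l' → Σ T₁.Q λ q₁' →
                  WStep T₁ q₁ l' q₁' × (dL l l' ≤∞ h) × B q₁' q₂'

    ApproxBisimilar : Set₁
    ApproxBisimilar =
      Σ (T₁.Q → T₂.Q → Set) λ B →
        IsApproxBisim B
        × (∀ q₁ → T₁.Init q₁ → Σ T₂.Q λ q₂ → T₂.Init q₂ × B q₁ q₂)
        × (∀ q₂ → T₂.Init q₂ → Σ T₁.Q λ q₁ → T₁.Init q₁ × B q₁ q₂)

-- Walk along the run of T₁, keeping a B-related partner state of T₂: the forward
-- clause of the bisimulation matches each step by a weak step with a label at
-- distance ≤ h, and the closeness clause bounds the observation distance by ε.
-- Past the end of a finite run the partner stays put and the label is junk (τ).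
module Submission where

open import Defs
open import Data.Nat using (ℕ; zero; suc; _<?_)
open import Data.Nat.Properties using (<⇒≤)
open import Data.Product using (Σ; _×_; _,_; proj₁; proj₂)
open import Data.Unit using (tt)
open import Data.Empty using (⊥-elim)
open import Relation.Nullary using (Dec; yes; no)
open import Relation.Binary.PropositionalEquality using (_≡_; refl; sym; subst)

module _ (R : RealLike) where
  open RealLike R using (ℝ)

  _<ₗ_ : ℕ → Len R → Set
  _<ₗ_ = _<L_ R

  _≤ₗ_ : ℕ → Len R → Set
  _≤ₗ_ = _≤L_ R

  _<L?_ : ∀ i n → Dec (i <ₗ n)
  i <L? finite m = i <? m
  i <L? infinite = yes tt

  <L⇒≤L : ∀ {i} n → i <ₗ n → i ≤ₗ n
  <L⇒≤L (finite m) = <⇒≤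
  <L⇒≤L infinite _ = tt

  suc≤L⇒<L : ∀ {i} n → suc i ≤ₗ n → i <ₗ n
  suc≤L⇒<L (finite m) p = p
  suc≤L⇒<L infinite _ = tt

  Run : {E Y : Set} (T : TS R E Y) → Len R → (ℕ → TS.Q T) → (ℕ → Act R E) → Set
  Run T n q l = ∀ i → i <ₗ n → TS.step T (q i) (l i) (q (suc i))

  module _ {E Y : Set} (h : ℝ) (T₁ T₂ : TS R E Y) where
    private
      module T₁ = TS T₁
      module T₂ = TS T₂

    record MatchedStep (B : T₁.Q → T₂.Q → Set) (q₂ : T₂.Q) (l : Act R E) (q₁' : T₁.Q) : Set where
      constructor matched
      field
        label       : Act R E
        target      : T₂.Q
        weak-step   : WStep R T₂ q₂ label target
        label-close : _≤∞_ R (dL R l label) h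
        related     : B q₁' target

    Simulation : (T₁.Q → T₂.Q → Set) → Set
    Simulation B = ∀ {q₁ q₂ l q₁'} → B q₁ q₂ → T₁.step q₁ l q₁' → MatchedStep B q₂ l q₁'

    record WeakRunAlong (B : T₁.Q → T₂.Q → Set) (n : Len R) (q₁ : ℕ → T₁.Q) (l : ℕ → Act R E)
                        (q₂₀ : T₂.Q) : Set where
      field
        states       : ℕ → T₂.Q
        labels       : ℕ → Act R E
        starts       : states 0 ≡ q₂₀
        weak-steps   : ∀ i → i <ₗ n → WStep R T₂ (states i) (labels i) (states (suc i))
        related      : ∀ i → i ≤ₗ n → B (q₁ i) (states i)
        labels-close : ∀ i → i <ₗ n → _≤∞_ R (dL R (l i) (labels i)) h

    liftRun : ∀ {B} → Simulation B → ∀ {n q₁ l} → Run T₁ n q₁ l →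
              ∀ {q₂₀} → B (q₁ 0) q₂₀ → WeakRunAlong B n q₁ l q₂₀
    liftRun {B} simulate {n} {q₁} {l} run {q₂₀} related₀ = record
      { states       = states
      ; labels       = labels
      ; starts       = refl
      ; weak-steps   = weak-steps
      ; related      = λ i → proj₂ (partner i)
      ; labels-close = labels-close
      }
      where
        open MatchedStep

        Partner : ℕ → Set
        Partner i = Σ T₂.Q λ q₂ → i ≤ₗ n → B (q₁ i) q₂

        extend : ∀ {i} ((q₂ , _) : Partner i) → i <ₗ n → MatchedStep B q₂ (l i) (q₁ (suc i))
        extend {i} (_ , rel) p = simulate (rel (<L⇒≤L n p)) (run i p)

        partner : ∀ i → Partner i
        partner zero = q₂₀ , λ _ → related₀
        partner (suc i) with i <L? n
        ... | yes p = target (extend (partner i) p) , λ _ → related (extend (partner i) p)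
        ... | no ¬p = proj₁ (partner i) , λ q → ⊥-elim (¬p (suc≤L⇒<L n q))

        states : ℕ → T₂.Q
        states i = proj₁ (partner i)

        labels : ℕ → Act R E
        labels i with i <L? n
        ... | yes p = label (extend (partner i) p)
        ... | no _  = τ

        weak-steps : ∀ i → i <ₗ n → WStep R T₂ (states i) (labels i) (states (suc i))
        weak-steps i p with i <L? n
        ... | yes p′ = weak-step (extend (partner i) p′)
        ... | no ¬p  = ⊥-elim (¬p p)

        labels-close : ∀ i → i <ₗ n → _≤∞_ R (dL R (l i) (labels i)) h
        labels-close i p with i <L? n
        ... | yes p′ = label-close (extend (partner i) p′)
        ... | no ¬p  = ⊥-elim (¬p p)

    approxBisim⇒simulation : ∀ {d : Y → Y → ℝ} {ε} {B} →
                             IsApproxBisim R d h ε T₁ T₂ B → Simulation B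
    approxBisim⇒simulation bisim r s with IsApproxBisim.fwd bisim r s
    ... | l′ , q₂′ , w , c , b = matched l′ q₂′ w c b

lemma2 : (R : RealLike) → (E Y : Set) → (d : Y → Y → RealLike.ℝ R) → (h ε : RealLike.ℝ R) → (T₁ T₂ : TS R E Y) →
    ApproxBisimilar R d h ε T₁ T₂ →
    (n : Len R) (y₁ : ℕ → Y) (l : ℕ → Act R E) → ObsTraj R T₁ n y₁ l →
    Σ (ℕ → Y) λ y₂ → Σ (ℕ → Act R E) λ l' →
      WObsTraj R T₂ n y₂ l'
      × (∀ i → _≤L_ R i n → RealLike._≤ℝ_ R (d (y₁ i) (y₂ i)) ε)
      × (∀ i → _<L_ R i n → _≤∞_ R (dL R (l i) (l' i)) h)
lemma2 R E Y d h ε T₁ T₂ (B , bisim , initial₁ , _) n y₁ l (q₁ , q₁-initial , run , observes)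
  with initial₁ (q₁ 0) q₁-initial
... | q₂₀ , q₂₀-initial , related₀ =
  (λ i → TS.H T₂ (states i)) , labels ,
  (states , subst (TS.Init T₂) (sym starts) q₂₀-initial , weak-steps , λ _ _ → refl) ,
  (λ i i≤n → subst (λ y → RealLike._≤ℝ_ R (d y _) ε) (observes i i≤n)
                   (IsApproxBisim.close bisim (related i i≤n))) ,
  labels-close
  where
    open WeakRunAlong
           (liftRun R h T₁ T₂ (approxBisim⇒simulation R h T₁ T₂ bisim) run related₀)
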